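{- Let $G$ be a regular graph and $n\ge 3$. If the strong product $G\boxtimes C_n$ is closed distance magic, then $n\equiv 0\pmod 3$ or $-1\in Sp(G)$.
   Context: $Sp(G)$ is the set of eigenvalues of the adjacency matrix of $G$; $C_n$ is the cycle on $n$ vertices. The strong product $G\boxtimes H$ has vertex set $V(G)\times V(H)$, and $(g,h)$, $(g',h')$ are adjacent iff either $g=g'$ and $hh'\in E(H)$, or $h=h'$ and $gg'\in E(G)$, or $gg'\in E(G)$ and $hh'\in E(H)$. A graph on $N$ vertices is closed distance magic if there is a bijection $\ell\colon V\to\{1,\dots,N\}$ and a positive integer $k'$ such that the sum of $\ell$ over the closed neighborhood of every vertex equals $k'$. -}

module Defs where

open import Data.Nat using (ℕ; zero; suc; _+_; _*_; _%_; _≡ᵇ_)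
open import Data.Fin using (Fin; zero; suc; toℕ; remQuot)
open import Data.Fin.Properties using (_≟_)
open import Data.Bool using (Bool; true; false; _∨_; _∧_; if_then_else_)
open import Data.Integer as ℤ using (ℤ)
open import Data.Product using (Σ; ∃; _×_; _,_; proj₁; proj₂)
open import Relation.Binary.PropositionalEquality using (_≡_; _≢_)
open import Relation.Nullary.Decidable using (⌊_⌋)
open import Function.Definitions using (Bijective)

record Graph : Set where
  constructor mkGraph
  field
    N   : ℕ
    adj : Fin N → Fin N → Bool
open Graph public

IsSimple : Graph → Set
IsSimple G = (∀ u v → adj G u v ≡ adj G v u) × (∀ v → adj G v v ≡ false)

sumFin : (n : ℕ) → (Fin n → ℕ) → ℕ
sumFin zero    f = 0
sumFin (suc n) f = f zero + sumFin n (λ i → f (suc i))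

sumFinℤ : (n : ℕ) → (Fin n → ℤ) → ℤ
sumFinℤ zero    f = ℤ.+ 0
sumFinℤ (suc n) f = f zero ℤ.+ sumFinℤ n (λ i → f (suc i))

degree : (G : Graph) → Fin (N G) → ℕ
degree G v = sumFin (N G) (λ u → if adj G v u then 1 else 0)

IsRegular : Graph → Set
IsRegular G = ∃ λ r → ∀ v → degree G v ≡ r

cycle : ℕ → Graph
cycle zero    = mkGraph zero (λ ())
cycle (suc m) = mkGraph (suc m) (λ i j →
  (toℕ j ≡ᵇ ((toℕ i + 1) % suc m)) ∨ (toℕ i ≡ᵇ ((toℕ j + 1) % suc m)))

-- strong product; vertex (g , h) of V(G) × V(H) is encoded as combine g h : Fin (N G * N H)
strongProduct : Graph → Graph → Graph
strongProduct G H = mkGraph (N G * N H) adjS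
  where
  adjS : Fin (N G * N H) → Fin (N G * N H) → Bool
  adjS x y with remQuot (N H) x | remQuot (N H) y
  ... | (g , h) | (g' , h') =
        (⌊ g ≟ g' ⌋ ∧ adj H h h')
      ∨ (⌊ h ≟ h' ⌋ ∧ adj G g g')
      ∨ (adj G g g' ∧ adj H h h')

-- closed distance magic: a bijection ℓ : V → {1,…,N} (encoded as Fin N, label toℕ (ℓ v) + 1)
-- and a positive k' with Σ_{u ∈ N[v]} ℓ(u) = k' for all v.
closedNbhdSum : (G : Graph) → (Fin (N G) → Fin (N G)) → Fin (N G) → ℕ
closedNbhdSum G ℓ v =
  sumFin (N G) (λ u → if (adj G v u ∨ ⌊ u ≟ v ⌋) then suc (toℕ (ℓ u)) else 0)

IsClosedDistanceMagic : Graph → Set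
IsClosedDistanceMagic G =
  Σ (Fin (N G) → Fin (N G)) λ ℓ → Bijective _≡_ _≡_ ℓ ×
    (∃ λ k' → (0 Data.Nat.< k') × (∀ v → closedNbhdSum G ℓ v ≡ k'))

InSpectrum : ℤ → Graph → Set
InSpectrum λ' G =
  Σ (Fin (N G) → ℤ) λ x → (∃ λ v → x v ≢ ℤ.+ 0) ×
    (∀ v → sumFinℤ (N G) (λ u → if adj G v u then x u else ℤ.+ 0) ≡ λ' ℤ.* x v)

module Submission where

-- The closed neighbourhood of (g, h) in G ⊠ H is N[g] × N[h], so the closed sum of a labelling ℓ
-- at (g, h) is the closed sum, over the cycle vertex h, of Φ_g(h') = Σ_{g' ∈ N[g]} ℓ(g', h').
-- Magic makes Φ_g(h − 1) + Φ_g(h) + Φ_g(h + 1) constant, so Φ_g has period 3 along C_n; if 3 ∤ n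
-- this forces Φ_g(0) = Φ_g(b) for one vertex b ≠ 0 independent of g. Then x = ℓ(·, 0) − ℓ(·, b)
-- satisfies (A + I) x = 0, and x ≠ 0 because ℓ is injective, so −1 is an eigenvalue of G.

open import Defs
open import Data.Bool using (Bool; true; false; _∧_; _∨_; if_then_else_)
open import Data.Bool.Properties using (∨-identityʳ)
open import Data.Bool.Solver using (module ∨-∧-Solver)
open import Data.Fin using (Fin; zero; suc; toℕ; combine; _↑ˡ_; _↑ʳ_; fromℕ<)
open import Data.Fin.Properties
  using (_≟_; suc-injective; toℕ-injective; toℕ-fromℕ<; toℕ<n; combine-injective; remQuot-combine)
open import Data.Integer as ℤ using (ℤ; -[1+_])
import Data.Integer.Properties as ℤₚ
import Data.Integer.Tactic.RingSolver as ℤ-Solver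
open import Data.Nat using (ℕ; zero; suc; pred; _+_; _*_; _≡ᵇ_; _%_; _/_; _≤_; _<_; s≤s; z≤n; NonZero)
open import Data.Nat.DivMod using (_mod_; m≡m%n+[m/n]*n; m<n⇒m%n≡m; %-distribˡ-+; m%n%n≡m%n; [m+n]%n≡m%n)
open import Data.Nat.Properties
  using (+-0-commutativeMonoid; +-assoc; +-comm; +-identityʳ; +-cancelˡ-≡; *-suc;
         ≤-refl; ≤-trans; m≤m+n; <⇒≱; <⇒≢; ≡ᵇ⇒≡; ≡⇒≡ᵇ)
import Data.Nat.Tactic.RingSolver as ℕ-Solver
open import Algebra.Properties.CommutativeMonoid.Sum +-0-commutativeMonoid
  using (sum; sum-cong-≗; sum-replicate-zero; ∑-distrib-+; ∑-comm)
open import Data.Product using (∃; _×_; _,_; proj₁; proj₂)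
open import Data.Sum using (_⊎_; inj₁; inj₂)
open import Function using (_∘_)
open import Function.Bundles using (_⇔_; mk⇔)
open import Relation.Binary.PropositionalEquality
open import Relation.Nullary using (yes; no)
open import Relation.Nullary.Decidable using (Dec; ⌊_⌋; does; isYes≗does; does-⇔; _×-dec_; T?)
open import Relation.Nullary.Negation using (contradiction)

-- ⌊_⌋ matches on the `because` constructor, so it is stuck on Fin's _≟_ (built with map′);
-- these lemmas recover the expected computation rules.
isYes-⇔ : ∀ {a b} {A : Set a} {B : Set b} → A ⇔ B → (a? : Dec A) (b? : Dec B) → ⌊ a? ⌋ ≡ ⌊ b? ⌋
isYes-⇔ A⇔B a? b? = trans (isYes≗does a?) (trans (does-⇔ A⇔B a? b?) (sym (isYes≗does b?)))

≟-suc : ∀ {n} (i j : Fin n) → ⌊ suc i ≟ suc j ⌋ ≡ ⌊ i ≟ j ⌋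
≟-suc i j = isYes-⇔ (mk⇔ suc-injective (cong suc)) (suc i ≟ suc j) (i ≟ j)

≟-sym : ∀ {n} (i j : Fin n) → ⌊ i ≟ j ⌋ ≡ ⌊ j ≟ i ⌋
≟-sym i j = isYes-⇔ (mk⇔ sym sym) (i ≟ j) (j ≟ i)

≟-toℕ : ∀ {n} (i j : Fin n) → ⌊ i ≟ j ⌋ ≡ (toℕ i ≡ᵇ toℕ j)
≟-toℕ i j = trans (isYes-⇔ equiv (i ≟ j) (T? (toℕ i ≡ᵇ toℕ j))) (isYes≗does (T? (toℕ i ≡ᵇ toℕ j)))
  where
  equiv = mk⇔ (λ i≡j → ≡⇒≡ᵇ _ _ (cong toℕ i≡j)) (λ t → toℕ-injective (≡ᵇ⇒≡ _ _ t))

≟-combine : ∀ {m n} (g g' : Fin m) (h h' : Fin n) →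
  ⌊ combine g h ≟ combine g' h' ⌋ ≡ ⌊ g ≟ g' ⌋ ∧ ⌊ h ≟ h' ⌋
≟-combine g g' h h' = begin
  ⌊ combine g h ≟ combine g' h' ⌋  ≡⟨ isYes-⇔ equiv _ ((g ≟ g') ×-dec (h ≟ h')) ⟩
  ⌊ (g ≟ g') ×-dec (h ≟ h') ⌋      ≡⟨ isYes≗does ((g ≟ g') ×-dec (h ≟ h')) ⟩
  does (g ≟ g') ∧ does (h ≟ h')    ≡⟨ sym (cong₂ _∧_ (isYes≗does (g ≟ g')) (isYes≗does (h ≟ h'))) ⟩
  ⌊ g ≟ g' ⌋ ∧ ⌊ h ≟ h' ⌋          ∎
  where
  open ≡-Reasoning
  equiv = mk⇔ (combine-injective g h g' h') (λ { (refl , refl) → refl })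

sumFin≡sum : ∀ n (f : Fin n → ℕ) → sumFin n f ≡ sum f
sumFin≡sum zero    f = refl
sumFin≡sum (suc n) f = cong (f zero +_) (sumFin≡sum n (λ i → f (suc i)))

sum-↑ : ∀ m n (f : Fin (m + n) → ℕ) → sum f ≡ sum {m} (λ i → f (i ↑ˡ n)) + sum {n} (λ j → f (m ↑ʳ j))
sum-↑ zero    n f = refl
sum-↑ (suc m) n f = trans (cong (f zero +_) (sum-↑ m n (λ i → f (suc i)))) (sym (+-assoc (f zero) _ _))

sum-combine : ∀ m n (f : Fin (m * n) → ℕ) → sum f ≡ sum {m} (λ i → sum {n} (λ j → f (combine i j)))
sum-combine zero    n f = refl
sum-combine (suc m) n f =
  trans (sum-↑ n (m * n) f) (cong (sum (λ j → f (j ↑ˡ (m * n))) +_) (sum-combine m n (λ k → f (n ↑ʳ k))))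

sum-if : ∀ {n} b (f : Fin n → ℕ) → sum (λ i → if b then f i else 0) ≡ (if b then sum f else 0)
sum-if     true  f = refl
sum-if {n} false f = sum-replicate-zero n

sum-δ : ∀ {n} (a : Fin n) (f : Fin n → ℕ) → sum (λ i → if ⌊ i ≟ a ⌋ then f i else 0) ≡ f a
sum-δ {suc n} zero    f = trans (cong (f zero +_) (sum-replicate-zero n)) (+-identityʳ (f zero))
sum-δ {suc n} (suc a) f =
  trans (sum-cong-≗ (λ i → cong (if_then f (suc i) else 0) (≟-suc i a))) (sum-δ a (λ i → f (suc i)))

sum-δ₃ : ∀ {n} {a b c : Fin n} → a ≢ b → a ≢ c → b ≢ c → ∀ (f : Fin n → ℕ) →
  sum (λ u → if (⌊ u ≟ a ⌋ ∨ ⌊ u ≟ b ⌋) ∨ ⌊ u ≟ c ⌋ then f u else 0) ≡ f a + f b + f c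
sum-δ₃ {a = a} {b} {c} a≢b a≢c b≢c f = begin
  sum (λ u → if (⌊ u ≟ a ⌋ ∨ ⌊ u ≟ b ⌋) ∨ ⌊ u ≟ c ⌋ then f u else 0)
    ≡⟨ sum-cong-≗ split ⟩
  sum (λ u → δ a u + δ b u + δ c u)
    ≡⟨ ∑-distrib-+ (λ u → δ a u + δ b u) (δ c) ⟩
  sum (λ u → δ a u + δ b u) + sum (δ c)
    ≡⟨ cong (_+ sum (δ c)) (∑-distrib-+ (δ a) (δ b)) ⟩
  sum (δ a) + sum (δ b) + sum (δ c)
    ≡⟨ cong₂ _+_ (cong₂ _+_ (sum-δ a f) (sum-δ b f)) (sum-δ c f) ⟩
  f a + f b + f c ∎
  where
  open ≡-Reasoning
  δ : Fin _ → Fin _ → ℕ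
  δ x u = if ⌊ u ≟ x ⌋ then f u else 0
  split : ∀ u → (if (⌊ u ≟ a ⌋ ∨ ⌊ u ≟ b ⌋) ∨ ⌊ u ≟ c ⌋ then f u else 0) ≡ δ a u + δ b u + δ c u
  split u with u ≟ a | u ≟ b | u ≟ c
  ... | yes refl | no _     | no _     = sym (trans (+-identityʳ _) (+-identityʳ (f u)))
  ... | no _     | yes refl | no _     = sym (+-identityʳ (f u))
  ... | no _     | no _     | yes refl = refl
  ... | no _     | no _     | no _     = refl
  ... | yes u≡a  | yes u≡b  | _        = contradiction (trans (sym u≡a) u≡b) a≢b
  ... | yes u≡a  | _        | yes u≡c  = contradiction (trans (sym u≡a) u≡c) a≢c
  ... | _        | yes u≡b  | yes u≡c  = contradiction (trans (sym u≡b) u≡c) b≢c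

closedAdj : (G : Graph) → Fin (N G) → Fin (N G) → Bool
closedAdj G v u = adj G v u ∨ ⌊ u ≟ v ⌋

closedSum : (G : Graph) → (Fin (N G) → ℕ) → Fin (N G) → ℕ
closedSum G f v = sum (λ u → if closedAdj G v u then f u else 0)

adj-strongProduct : ∀ G H (g g' : Fin (N G)) (h h' : Fin (N H)) →
  adj (strongProduct G H) (combine g h) (combine g' h') ≡
  (⌊ g ≟ g' ⌋ ∧ adj H h h') ∨ (⌊ h ≟ h' ⌋ ∧ adj G g g') ∨ (adj G g g' ∧ adj H h h')
-- remQuot is swap ∘ quotRem, so strongProduct only computes after rewriting the projections.
adj-strongProduct G H g g' h h'
  rewrite cong proj₁ (remQuot-combine {N G} {N H} g h) | cong proj₂ (remQuot-combine {N G} {N H} g h)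
        | cong proj₁ (remQuot-combine {N G} {N H} g' h') | cong proj₂ (remQuot-combine {N G} {N H} g' h')
  = refl

closedAdj-strongProduct : ∀ G H (g g' : Fin (N G)) (h h' : Fin (N H)) →
  closedAdj (strongProduct G H) (combine g h) (combine g' h') ≡ closedAdj H h h' ∧ closedAdj G g g'
closedAdj-strongProduct G H g g' h h'
  rewrite adj-strongProduct G H g g' h h' | ≟-combine g' g h' h | ≟-sym g g' | ≟-sym h h'
  = closedness ⌊ g' ≟ g ⌋ ⌊ h' ≟ h ⌋ (adj G g g') (adj H h h')
  where
  open ∨-∧-Solver
  closedness : ∀ eg eh ag ah → ((eg ∧ ah) ∨ (eh ∧ ag) ∨ (ag ∧ ah)) ∨ (eg ∧ eh) ≡ (ah ∨ eh) ∧ (ag ∨ eg)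
  closedness = solve 4 (λ eg eh ag ah →
    ((eg :* ah) :+ ((eh :* ag) :+ (ag :* ah))) :+ (eg :* eh) := (ah :+ eh) :* (ag :+ eg)) refl

if-∧ : ∀ {A : Set} p q (x z : A) → (if p ∧ q then x else z) ≡ (if p then (if q then x else z) else z)
if-∧ true  q x z = refl
if-∧ false q x z = refl

closedSum-strongProduct : ∀ G H (f : Fin (N G * N H) → ℕ) g h →
  closedSum (strongProduct G H) f (combine g h) ≡
  closedSum H (λ h' → closedSum G (λ g' → f (combine g' h')) g) h
closedSum-strongProduct G H f g h = begin
  closedSum (strongProduct G H) f (combine g h)  ≡⟨ sum-combine (N G) (N H) _ ⟩
  sum (λ g' → sum (λ h' → inProduct g' h'))      ≡⟨ sum-cong-≗ (λ g' → sum-cong-≗ (inProduct≡inFactors g')) ⟩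
  sum (λ g' → sum (λ h' → inFactors g' h'))      ≡⟨ ∑-comm inFactors ⟩
  sum (λ h' → sum (λ g' → inFactors g' h'))      ≡⟨ sum-cong-≗ (λ h' → sum-if (closedAdj H h h') (inG h')) ⟩
  closedSum H (λ h' → closedSum G (λ g' → f (combine g' h')) g) h  ∎
  where
  open ≡-Reasoning
  inG : Fin (N H) → Fin (N G) → ℕ
  inG h' g' = if closedAdj G g g' then f (combine g' h') else 0
  inProduct inFactors : Fin (N G) → Fin (N H) → ℕ
  inProduct g' h' = if closedAdj (strongProduct G H) (combine g h) (combine g' h') then f (combine g' h') else 0
  inFactors g' h' = if closedAdj H h h' then inG h' g' else 0
  inProduct≡inFactors : ∀ g' h' → inProduct g' h' ≡ inFactors g' h'
  inProduct≡inFactors g' h' =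
    trans (cong (if_then f (combine g' h') else 0) (closedAdj-strongProduct G H g g' h h'))
          (if-∧ (closedAdj H h h') (closedAdj G g g') _ 0)

adjSum : (G : Graph) → (Fin (N G) → ℕ) → Fin (N G) → ℕ
adjSum G f v = sum (λ u → if adj G v u then f u else 0)

closedSum≡adjSum+self : ∀ G → (∀ v → adj G v v ≡ false) →
  ∀ f v → closedSum G f v ≡ adjSum G f v + f v
closedSum≡adjSum+self G loopless f v =
  trans (sum-cong-≗ split)
    (trans (∑-distrib-+ (λ u → if adj G v u then f u else 0) (λ u → if ⌊ u ≟ v ⌋ then f u else 0))
           (cong (adjSum G f v +_) (sum-δ v f)))
  where
  split : ∀ u → (if closedAdj G v u then f u else 0) ≡
                (if adj G v u then f u else 0) + (if ⌊ u ≟ v ⌋ then f u else 0)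
  split u with u ≟ v
  ... | yes refl rewrite loopless u = refl
  ... | no _ rewrite ∨-identityʳ (adj G v u) = sym (+-identityʳ _)

sumFinℤ-if-difference : ∀ n (b : Fin n → Bool) (f₁ f₂ : Fin n → ℕ) →
  sumFinℤ n (λ u → if b u then ℤ.+ f₁ u ℤ.- ℤ.+ f₂ u else ℤ.+ 0) ≡
  ℤ.+ sumFin n (λ u → if b u then f₁ u else 0) ℤ.- ℤ.+ sumFin n (λ u → if b u then f₂ u else 0)
sumFinℤ-if-difference zero    b f₁ f₂ = refl
sumFinℤ-if-difference (suc n) b f₁ f₂ with b zero
... | false = trans (ℤₚ.+-identityˡ _) (sumFinℤ-if-difference n (b ∘ suc) (f₁ ∘ suc) (f₂ ∘ suc))
... | true  = begin
  (ℤ.+ f₁ zero ℤ.- ℤ.+ f₂ zero) ℤ.+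
    sumFinℤ n (λ u → if b (suc u) then ℤ.+ f₁ (suc u) ℤ.- ℤ.+ f₂ (suc u) else ℤ.+ 0)
    ≡⟨ cong (ℤ._+_ (ℤ.+ f₁ zero ℤ.- ℤ.+ f₂ zero)) (sumFinℤ-if-difference n (b ∘ suc) (f₁ ∘ suc) (f₂ ∘ suc)) ⟩
  (ℤ.+ f₁ zero ℤ.- ℤ.+ f₂ zero) ℤ.+ (ℤ.+ S₁ ℤ.- ℤ.+ S₂)
    ≡⟨ interchange (ℤ.+ f₁ zero) (ℤ.+ f₂ zero) (ℤ.+ S₁) (ℤ.+ S₂) ⟩
  (ℤ.+ f₁ zero ℤ.+ ℤ.+ S₁) ℤ.- (ℤ.+ f₂ zero ℤ.+ ℤ.+ S₂)
    ≡⟨ sym (cong₂ ℤ._-_ (ℤₚ.pos-+ (f₁ zero) S₁) (ℤₚ.pos-+ (f₂ zero) S₂)) ⟩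
  ℤ.+ (f₁ zero + S₁) ℤ.- ℤ.+ (f₂ zero + S₂) ∎
  where
  open ≡-Reasoning
  S₁ = sumFin n (λ u → if b (suc u) then f₁ (suc u) else 0)
  S₂ = sumFin n (λ u → if b (suc u) then f₂ (suc u) else 0)
  interchange : ∀ (p q r s : ℤ) → (p ℤ.- q) ℤ.+ (r ℤ.- s) ≡ (p ℤ.+ r) ℤ.- (q ℤ.+ s)
  interchange = ℤ-Solver.solve-∀

opposite-differences : ∀ a b c d → a + c ≡ b + d → ℤ.+ a ℤ.- ℤ.+ b ≡ -[1+ 0 ] ℤ.* (ℤ.+ c ℤ.- ℤ.+ d)
opposite-differences a b c d a+c≡b+d = ℤₚ.i-j≡0⇒i≡j _ _ (begin
  (ℤ.+ a ℤ.- ℤ.+ b) ℤ.- -[1+ 0 ] ℤ.* (ℤ.+ c ℤ.- ℤ.+ d) ≡⟨ regroup (ℤ.+ a) (ℤ.+ b) (ℤ.+ c) (ℤ.+ d) ⟩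
  (ℤ.+ a ℤ.+ ℤ.+ c) ℤ.- (ℤ.+ b ℤ.+ ℤ.+ d)              ≡⟨ sym (cong₂ ℤ._-_ (ℤₚ.pos-+ a c) (ℤₚ.pos-+ b d)) ⟩
  ℤ.+ (a + c) ℤ.- ℤ.+ (b + d)                          ≡⟨ cong (λ z → ℤ.+ z ℤ.- ℤ.+ (b + d)) a+c≡b+d ⟩
  ℤ.+ (b + d) ℤ.- ℤ.+ (b + d)                          ≡⟨ ℤₚ.+-inverseʳ (ℤ.+ (b + d)) ⟩
  ℤ.+ 0                                                ∎)
  where
  open ≡-Reasoning
  regroup : ∀ (p q r s : ℤ) → (p ℤ.- q) ℤ.- -[1+ 0 ] ℤ.* (r ℤ.- s) ≡ (p ℤ.+ r) ℤ.- (q ℤ.+ s)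
  regroup = ℤ-Solver.solve-∀

sameClosedSums⇒minusOne∈Sp : ∀ G → (∀ v → adj G v v ≡ false) → (f₁ f₂ : Fin (N G) → ℕ) →
  (∀ v → closedSum G f₁ v ≡ closedSum G f₂ v) → (w : Fin (N G)) → f₁ w ≢ f₂ w →
  InSpectrum -[1+ 0 ] G
sameClosedSums⇒minusOne∈Sp G loopless f₁ f₂ sameClosedSums w f₁w≢f₂w = x , (w , x[w]≢0) , eigen
  where
  x : Fin (N G) → ℤ
  x u = ℤ.+ f₁ u ℤ.- ℤ.+ f₂ u
  x[w]≢0 : x w ≢ ℤ.+ 0
  x[w]≢0 = f₁w≢f₂w ∘ ℤₚ.+-injective ∘ ℤₚ.i-j≡0⇒i≡j _ _
  eigen : ∀ v → sumFinℤ (N G) (λ u → if adj G v u then x u else ℤ.+ 0) ≡ -[1+ 0 ] ℤ.* x v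
  eigen v = begin
    sumFinℤ (N G) (λ u → if adj G v u then x u else ℤ.+ 0)
      ≡⟨ sumFinℤ-if-difference (N G) (adj G v) f₁ f₂ ⟩
    ℤ.+ sumFin (N G) (λ u → if adj G v u then f₁ u else 0) ℤ.-
      ℤ.+ sumFin (N G) (λ u → if adj G v u then f₂ u else 0)
      ≡⟨ cong₂ (λ s₁ s₂ → ℤ.+ s₁ ℤ.- ℤ.+ s₂) (sumFin≡sum (N G) _) (sumFin≡sum (N G) _) ⟩
    ℤ.+ adjSum G f₁ v ℤ.- ℤ.+ adjSum G f₂ v
      ≡⟨ opposite-differences _ _ (f₁ v) (f₂ v) sameAdjSums ⟩
    -[1+ 0 ] ℤ.* x v ∎
    where
    open ≡-Reasoning
    sameAdjSums : adjSum G f₁ v + f₁ v ≡ adjSum G f₂ v + f₂ v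
    sameAdjSums = trans (sym (closedSum≡adjSum+self G loopless f₁ v))
                        (trans (sameClosedSums v) (closedSum≡adjSum+self G loopless f₂ v))

[m+k]%n≢m : ∀ m {k n} .{{_ : NonZero n}} → 0 < k → k < n → (m + k) % n ≢ m
[m+k]%n≢m m {k} {n} 0<k k<n [m+k]%n≡m = k≢q*n ((m + k) / n) k≡q*n
  where
  k≡q*n : k ≡ (m + k) / n * n
  k≡q*n = +-cancelˡ-≡ m _ _ (trans (m≡m%n+[m/n]*n (m + k) n) (cong (_+ (m + k) / n * n) [m+k]%n≡m))
  k≢q*n : ∀ q → k ≢ q * n
  k≢q*n zero    k≡0   = <⇒≢ 0<k (sym k≡0)
  k≢q*n (suc q) k≡n+_ = <⇒≱ k<n (subst (n ≤_) (sym k≡n+_) (m≤m+n n (q * n)))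

module Cycle (m : ℕ) where

  at : ℕ → Fin (suc m)
  at j = j mod suc m

  next prev : Fin (suc m) → Fin (suc m)
  next i = at (toℕ i + 1)
  prev i = at (toℕ i + m)

  toℕ-at : ∀ j → toℕ (at j) ≡ j % suc m
  toℕ-at j = toℕ-fromℕ< _

  at-cong : ∀ j j' → j % suc m ≡ j' % suc m → at j ≡ at j'
  at-cong j j' e = toℕ-injective (trans (toℕ-at j) (trans e (sym (toℕ-at j'))))

  at-toℕ : ∀ i → at (toℕ i) ≡ i
  at-toℕ i = toℕ-injective (trans (toℕ-at (toℕ i)) (m<n⇒m%n≡m (toℕ<n i)))

  at-+ : ∀ j k → at (toℕ (at j) + k) ≡ at (j + k)
  at-+ j k = at-cong (toℕ (at j) + k) (j + k) (begin
    (toℕ (at j) + k) % suc m                ≡⟨ cong (λ r → (r + k) % suc m) (toℕ-at j) ⟩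
    (j % suc m + k) % suc m                 ≡⟨ %-distribˡ-+ (j % suc m) k (suc m) ⟩
    (j % suc m % suc m + k % suc m) % suc m ≡⟨ cong (λ r → (r + k % suc m) % suc m) (m%n%n≡m%n j (suc m)) ⟩
    (j % suc m + k % suc m) % suc m         ≡⟨ sym (%-distribˡ-+ j k (suc m)) ⟩
    (j + k) % suc m                         ∎)
    where open ≡-Reasoning

  at-periodic : ∀ j → at (suc m + j) ≡ at j
  at-periodic j =
    at-cong (suc m + j) j (trans (cong (_% suc m) (+-comm (suc m) j)) ([m+n]%n≡m%n j (suc m)))

  next-at : ∀ j → next (at j) ≡ at (suc j)
  next-at j = trans (at-+ j 1) (cong at (+-comm j 1))

  prev-next : ∀ i → prev (next i) ≡ i
  prev-next i = begin
    at (toℕ (at (toℕ i + 1)) + m) ≡⟨ at-+ (toℕ i + 1) m ⟩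
    at (toℕ i + 1 + m)            ≡⟨ cong at (rearrange (toℕ i) m) ⟩
    at (suc m + toℕ i)            ≡⟨ at-periodic (toℕ i) ⟩
    at (toℕ i)                    ≡⟨ at-toℕ i ⟩
    i                             ∎
    where
    open ≡-Reasoning
    rearrange : ∀ a m → a + 1 + m ≡ suc m + a
    rearrange = ℕ-Solver.solve-∀

  next-prev : ∀ i → next (prev i) ≡ i
  next-prev i = begin
    at (toℕ (at (toℕ i + m)) + 1) ≡⟨ at-+ (toℕ i + m) 1 ⟩
    at (toℕ i + m + 1)            ≡⟨ cong at (rearrange (toℕ i) m) ⟩
    at (suc m + toℕ i)            ≡⟨ at-periodic (toℕ i) ⟩
    at (toℕ i)                    ≡⟨ at-toℕ i ⟩
    i                             ∎
    where
    open ≡-Reasoning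
    rearrange : ∀ a m → a + m + 1 ≡ suc m + a
    rearrange = ℕ-Solver.solve-∀

  adj-cycle : ∀ i u → adj (cycle (suc m)) i u ≡ ⌊ u ≟ next i ⌋ ∨ ⌊ u ≟ prev i ⌋
  adj-cycle i u = sym (cong₂ _∨_
    (trans (≟-toℕ u (next i)) (cong (toℕ u ≡ᵇ_) (toℕ-at (toℕ i + 1))))
    (trans (isYes-⇔ (mk⇔ (λ { refl → sym (next-prev i) }) (λ { refl → sym (prev-next u) }))
                    (u ≟ prev i) (i ≟ next u))
           (trans (≟-toℕ i (next u)) (cong (toℕ i ≡ᵇ_) (toℕ-at (toℕ u + 1))))))

  at-+≢ : ∀ {k} → 0 < k → k < suc m → ∀ i → at (toℕ i + k) ≢ i
  at-+≢ {k} 0<k k<n i e = [m+k]%n≢m (toℕ i) 0<k k<n (trans (sym (toℕ-at (toℕ i + k))) (cong toℕ e))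

  module _ (2≤m : 2 ≤ m) where

    next≢self : ∀ i → next i ≢ i
    next≢self = at-+≢ (s≤s z≤n) (s≤s (≤-trans (s≤s z≤n) 2≤m))

    prev≢self : ∀ i → prev i ≢ i
    prev≢self = at-+≢ (≤-trans (s≤s z≤n) 2≤m) ≤-refl

    next≢prev : ∀ i → next i ≢ prev i
    next≢prev i next≡prev = at-+≢ (s≤s z≤n) (s≤s 2≤m) i (begin
      at (toℕ i + 2)             ≡⟨ cong at (+-assoc (toℕ i) 1 1) ⟨
      at (toℕ i + 1 + 1)         ≡⟨ at-+ (toℕ i + 1) 1 ⟨
      next (next i)              ≡⟨ cong next next≡prev ⟩
      next (prev i)              ≡⟨ next-prev i ⟩
      i                          ∎)
      where open ≡-Reasoning

    closedSum-cycle : ∀ Φ i → closedSum (cycle (suc m)) Φ i ≡ Φ (next i) + Φ (prev i) + Φ i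
    closedSum-cycle Φ i =
      trans (sum-cong-≗ (λ u → cong (λ b → if b ∨ ⌊ u ≟ i ⌋ then Φ u else 0) (adj-cycle i u)))
            (sum-δ₃ (next≢prev i) (next≢self i) (prev≢self i) Φ)

    module _ (Φ : Fin (suc m) → ℕ) (k : ℕ) (constant : ∀ i → closedSum (cycle (suc m)) Φ i ≡ k) where

      three-consecutive : ∀ j → Φ (at (2 + j)) + Φ (at j) + Φ (at (1 + j)) ≡ k
      three-consecutive j = begin
        Φ (at (2 + j)) + Φ (at j) + Φ (at (1 + j))
          ≡⟨ cong₂ (λ x y → Φ x + Φ y + Φ (at (1 + j))) (next-at (1 + j)) prev-at-suc ⟨
        Φ (next (at (1 + j))) + Φ (prev (at (1 + j))) + Φ (at (1 + j))
          ≡⟨ closedSum-cycle Φ (at (1 + j)) ⟨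
        closedSum (cycle (suc m)) Φ (at (1 + j))
          ≡⟨ constant (at (1 + j)) ⟩
        k ∎
        where
        open ≡-Reasoning
        prev-at-suc : prev (at (1 + j)) ≡ at j
        prev-at-suc = trans (cong prev (sym (next-at j))) (prev-next (at j))

      period-three : ∀ j → Φ (at j) ≡ Φ (at (3 + j))
      period-three j = cancel _ _ _ _ (trans (three-consecutive j) (sym (three-consecutive (1 + j))))
        where
        cancel : ∀ x y z w → x + y + z ≡ w + z + x → y ≡ w
        cancel x y z w e = +-cancelˡ-≡ (x + z) y w (trans (regroup₁ x y z) (trans e (regroup₂ x z w)))
          where
          regroup₁ : ∀ x y z → x + z + y ≡ x + y + z
          regroup₁ = ℕ-Solver.solve-∀
          regroup₂ : ∀ x z w → w + z + x ≡ x + z + w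
          regroup₂ = ℕ-Solver.solve-∀

      period-multiple-of-three : ∀ t → Φ zero ≡ Φ (at (3 * t))
      period-multiple-of-three zero    = refl
      period-multiple-of-three (suc t) =
        trans (period-multiple-of-three t) (trans (period-three (3 * t)) (cong (Φ ∘ at) (sym (*-suc 3 t))))

    coincidence : ∀ t r → 0 < r → r < suc m → 3 * t ≡ suc m + r →
      ∃ λ (b : Fin (suc m)) → b ≢ zero ×
        ∀ Φ k → (∀ i → closedSum (cycle (suc m)) Φ i ≡ k) → Φ zero ≡ Φ b
    coincidence t r 0<r r<n 3t≡n+r = at r , at-+≢ 0<r r<n zero , λ Φ k constant →
      trans (period-multiple-of-three Φ k constant t) (cong Φ (trans (cong at 3t≡n+r) (at-periodic r)))

residue-view : ∀ n → n % 3 ≡ 0 ⊎ (∃ λ t → 3 * t ≡ n + 2) ⊎ (∃ λ t → 3 * t ≡ n + 1)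
residue-view 0 = inj₁ refl
residue-view 1 = inj₂ (inj₁ (1 , refl))
residue-view 2 = inj₂ (inj₂ (1 , refl))
residue-view (suc (suc (suc n))) with residue-view n
... | inj₁ n%3≡0        = inj₁ (trans (cong (_% 3) (+-comm 3 n)) (trans ([m+n]%n≡m%n n 3) n%3≡0))
... | inj₂ (inj₁ (t , e)) = inj₂ (inj₁ (suc t , trans (*-suc 3 t) (cong (3 +_) e)))
... | inj₂ (inj₂ (t , e)) = inj₂ (inj₂ (suc t , trans (*-suc 3 t) (cong (3 +_) e)))

cycle-constantClosedSum⇒coincidence : ∀ m → 2 ≤ m →
  suc m % 3 ≡ 0 ⊎
  ∃ λ (b : Fin (suc m)) → b ≢ zero ×
    ∀ Φ k → (∀ i → closedSum (cycle (suc m)) Φ i ≡ k) → Φ zero ≡ Φ b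
cycle-constantClosedSum⇒coincidence m 2≤m with residue-view (suc m)
... | inj₁ n%3≡0          = inj₁ n%3≡0
... | inj₂ (inj₁ (t , e)) = inj₂ (Cycle.coincidence m 2≤m t 2 (s≤s z≤n) (s≤s 2≤m) e)
... | inj₂ (inj₂ (t , e)) = inj₂ (Cycle.coincidence m 2≤m t 1 (s≤s z≤n) (s≤s (≤-trans (s≤s z≤n) 2≤m)) e)

mainTheorem11 : (G : Graph) → IsSimple G → 1 ≤ N G → IsRegular G →
    (n : ℕ) → 3 ≤ n → IsClosedDistanceMagic (strongProduct G (cycle n)) →
    (n % 3 ≡ 0) ⊎ InSpectrum (-[1+ 0 ]) G
mainTheorem11 G (_ , loopless) 1≤N _ (suc m) (s≤s 2≤m) (ℓ , (ℓ-injective , _) , k' , _ , magic)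
  with cycle-constantClosedSum⇒coincidence m 2≤m
... | inj₁ n%3≡0 = inj₁ n%3≡0
... | inj₂ (b , b≢0 , coincide) =
  inj₂ (sameClosedSums⇒minusOne∈Sp G loopless (layer zero) (layer b) sameClosedSums v₀ layers-differ)
  where
  label : Fin (N G * suc m) → ℕ
  label x = suc (toℕ (ℓ x))
  layer : Fin (suc m) → Fin (N G) → ℕ
  layer h g = label (combine g h)
  sameClosedSums : ∀ g → closedSum G (layer zero) g ≡ closedSum G (layer b) g
  sameClosedSums g = coincide (λ h → closedSum G (layer h) g) k' λ h →
    trans (sym (closedSum-strongProduct G (cycle (suc m)) label g h))
          (trans (sym (sumFin≡sum (N G * suc m) _)) (magic (combine g h)))
  v₀ : Fin (N G)
  v₀ = fromℕ< 1≤N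
  layers-differ : layer zero v₀ ≢ layer b v₀
  layers-differ =
    b≢0 ∘ sym ∘ proj₂ ∘ combine-injective v₀ zero v₀ b ∘ ℓ-injective ∘ toℕ-injective ∘ cong pred
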